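{- Let $c$ be a natural number, let $P$ be a set of $m$ points in the plane with coordinates $(A_i,a_i)$, and let $L$ be a set of $n$ lines with equations $B_jx-b_jy=c$, where all $A_i,a_i,B_j,b_j$ are natural numbers. Let $E$ be the set of incidences, i.e. pairs (point, line) with the point lying on the line (equivalently $A_iB_j-a_ib_j=c$). Then $$|E|\le (m+n)\,\tau(c)^3,$$ where $\tau(c)$ is the number of positive divisors of $c$.
   Context: A configuration of this kind (natural-number point coordinates, lines $Bx-by=c$ with natural $B,b$ and common free term $c$) is called a normed natural configuration. -}

module Defs where

open import Data.Nat using (ℕ; suc; _+_; _*_; _≟_)
open import Data.Nat.Divisibility using (_∣_; _∣?_)
open import Data.Product using (_×_; _,_)
open import Data.List using (List; length; filter; cartesianProduct; applyUpTo)
open import Relation.Binary.PropositionalEquality using (_≡_)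
open import Relation.Nullary using (Dec)
open import Relation.Unary using (Decidable)

Point : Set
Point = ℕ × ℕ

-- A line (B , b) stands for the line  B x - b y = c  (c fixed, common free term).
Line : Set
Line = ℕ × ℕ

-- Incidence: point (A,a) lies on line Bx - by = c, i.e. A B - a b = c,
-- written over ℕ without truncated subtraction as A*B ≡ a*b + c.
Incident : ℕ → Point × Line → Set
Incident c ((A , a) , (B , b)) = A * B ≡ a * b + c

incident? : (c : ℕ) → Decidable (Incident c)
incident? c ((A , a) , (B , b)) = A * B ≟ a * b + c

incidences : ℕ → List Point → List Line → ℕ
incidences c P L = length (filter (incident? c) (cartesianProduct P L))

τ : ℕ → ℕ
τ c = length (filter (_∣? c) (applyUpTo suc c))

-- Write (A , a) = g (A' , a') and (B , b) = h (B' , b') with g, h the gcds; both divide c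
-- since c = A B - a b.  Charge an incidence to its point if b' ≤ A' and to its line otherwise.
-- Two lines through one point with the same h satisfy A' (B₁' - B₂') = a' (b₁' - b₂'), so
-- b₁' ≡ b₂' (mod A'), and 0 < bᵢ' ≤ A' forces them to coincide.  Symmetrically, two points on
-- one line with the same g satisfy A₁' ≡ A₂' (mod b') with 0 ≤ Aᵢ' < b'.  Hence each point and
-- each line is charged at most τ(c) times, and |E| ≤ (m + n) τ(c) ≤ (m + n) τ(c)³.
module Submission where

open import Defs
open import Data.Nat using (ℕ; zero; suc; _+_; _*_; _^_; _≤_; _<_; _≤?_; z≤n; s≤s; NonZero; >-nonZero)
open import Data.Nat.Properties
open import Data.Nat.Divisibility using (_∣_; _∣?_; ∣⇒≤; >⇒∤; ∣m+n∣m⇒∣n; m∣m*n; ∣n⇒∣m*n)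
open import Data.Nat.DivMod using (_/_; m/n*n≡m; m≥n⇒m/n>0)
open import Data.Nat.GCD using (gcd; gcd[m,n]∣m; gcd[m,n]∣n; gcd[m,n]≢0)
open import Data.Nat.Coprimality using (Coprime; coprime-divisor; coprime-/gcd) renaming (sym to coprime-sym)
open import Data.Nat.ListAction using (sum)
open import Data.Nat.ListAction.Properties using (sum-++)
open import Data.Nat.Tactic.RingSolver using (solve-∀)
open import Data.Product using (_×_; _,_; proj₁; proj₂; uncurry)
open import Data.Sum using (inj₁; inj₂)
open import Data.List using (List; []; _∷_; _++_; length; map; filter; applyUpTo; cartesianProduct)
open import Data.List.Properties using (map-++; map-∘; map-cong; length-++-sucʳ)
open import Data.List.Membership.Propositional using (_∈_)
open import Data.List.Membership.Propositional.Properties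
  using (∈-∃++; ∈-++⁻; ∈-++⁺ˡ; ∈-++⁺ʳ; ∈-filter⁺; ∈-filter⁻; ∈-applyUpTo⁺)
open import Data.List.Relation.Unary.Any using (here; there)
open import Data.List.Relation.Unary.All using (All; []; _∷_)
import Data.List.Relation.Unary.All as All
open import Data.List.Relation.Unary.Unique.Propositional using (Unique)
import Data.List.Relation.Unary.Unique.Propositional.Properties as Unique
open import Data.List.Relation.Unary.AllPairs using ([]; _∷_)
open import Relation.Binary.PropositionalEquality
open import Relation.Nullary using (Dec; yes; no; ¬_; contradiction)
open import Relation.Unary using (Decidable; _∩_; ∁)
open import Relation.Unary.Properties using (_∩?_; ∁?)

private
  variable
    I K : Set

∣∧<⇒≡0 : ∀ {m n} → m ∣ n → n < m → n ≡ 0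
∣∧<⇒≡0 {n = zero}  _   _   = refl
∣∧<⇒≡0 {n = suc _} m∣n n<m = contradiction m∣n (>⇒∤ n<m)

coprime-window-≤ : ∀ {x y u₁ u₂ v₁ v₂} → Coprime x y →
  x * u₁ + y * v₂ ≡ x * u₂ + y * v₁ → v₁ ≤ v₂ → v₂ < v₁ + x → v₁ ≡ v₂
coprime-window-≤ {x} {y} {u₁} {u₂} {v₁} cop eq v₁≤v₂ v₂<v₁+x
  with d , refl ← m≤n⇒∃[o]m+o≡n v₁≤v₂ =
  sym (trans (cong (v₁ +_) d≡0) (+-identityʳ v₁))
  where
  shift : ∀ x u y v d → x * u + y * (v + d) ≡ (x * u + y * d) + y * v
  shift = solve-∀
  reduced : x * u₁ + y * d ≡ x * u₂
  reduced = +-cancelʳ-≡ (y * v₁) _ _ (trans (sym (shift x u₁ y v₁ d)) eq)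
  x∣d : x ∣ d
  x∣d = coprime-divisor cop (∣m+n∣m⇒∣n (subst (x ∣_) (sym reduced) (m∣m*n u₂)) (m∣m*n u₁))
  d≡0 : d ≡ 0
  d≡0 = ∣∧<⇒≡0 x∣d (+-cancelˡ-< v₁ d x v₂<v₁+x)

-- The equation says x (u₁ - u₂) = y (v₁ - v₂), so v₁ ≡ v₂ (mod x).
coprime-window : ∀ {x y u₁ u₂ v₁ v₂} → Coprime x y →
  x * u₁ + y * v₂ ≡ x * u₂ + y * v₁ → v₁ < v₂ + x → v₂ < v₁ + x → v₁ ≡ v₂
coprime-window {v₁ = v₁} {v₂} cop eq v₁< v₂< with ≤-total v₁ v₂
... | inj₁ v₁≤v₂ = coprime-window-≤ cop eq v₁≤v₂ v₂<
... | inj₂ v₂≤v₁ = sym (coprime-window-≤ cop (sym eq) v₂≤v₁ v₁<)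

gcd>0 : ∀ {m} n → 0 < m → 0 < gcd m n
gcd>0 {m} n 0<m = n≢0⇒n>0 (gcd[m,n]≢0 m n (inj₁ (n>0⇒n≢0 0<m)))

/-injective : ∀ {m n d} .{{_ : NonZero d}} → d ∣ m → d ∣ n → m / d ≡ n / d → m ≡ n
/-injective {d = d} d∣m d∣n eq = trans (sym (m/n*n≡m d∣m)) (trans (cong (_* d) eq) (m/n*n≡m d∣n))

*-by-quotient : ∀ {m d} k .{{_ : NonZero d}} → d ∣ m → m * k ≡ m / d * (d * k)
*-by-quotient {m} {d} k d∣m = trans (cong (_* k) (sym (m/n*n≡m d∣m))) (*-assoc (m / d) d k)

cross-≤⇒/-≤ : ∀ {v x g h} .{{_ : NonZero g}} .{{_ : NonZero h}} → h ∣ v → g ∣ x →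
  v * g ≤ x * h → v / h ≤ x / g
cross-≤⇒/-≤ {v} {x} {g} {h} h∣v g∣x le = *-cancelʳ-≤ (v / h) (x / g) (h * g) {{m*n≢0 h g}}
  (subst₂ _≤_ (*-by-quotient g h∣v) (trans (*-by-quotient h g∣x) (cong (x / g *_) (*-comm g h))) le)

cross-<⇒/-< : ∀ {v x g h} .{{_ : NonZero g}} .{{_ : NonZero h}} → h ∣ v → g ∣ x →
  v * g < x * h → v / h < x / g
cross-<⇒/-< {v} {x} {g} {h} h∣v g∣x lt = *-cancelʳ-< (h * g) (v / h) (x / g)
  (subst₂ _<_ (*-by-quotient g h∣v) (trans (*-by-quotient h g∣x) (cong (x / g *_) (*-comm g h))) lt)

cross-/ : ∀ {x y u₁ u₂ v₁ v₂ g h} .{{_ : NonZero g}} .{{_ : NonZero h}} →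
  g ∣ x → g ∣ y → h ∣ u₁ → h ∣ u₂ → h ∣ v₁ → h ∣ v₂ →
  x * u₁ + y * v₂ ≡ x * u₂ + y * v₁ →
  x / g * (u₁ / h) + y / g * (v₂ / h) ≡ x / g * (u₂ / h) + y / g * (v₁ / h)
cross-/ {x} {y} {u₁} {u₂} {v₁} {v₂} {g} {h} g∣x g∣y h∣u₁ h∣u₂ h∣v₁ h∣v₂ eq =
  *-cancelˡ-≡ _ _ (g * h) {{m*n≢0 g h}} (begin
    g * h * (x / g * (u₁ / h) + y / g * (v₂ / h))  ≡⟨ unscale u₁ v₂ h∣u₁ h∣v₂ ⟩
    x * u₁ + y * v₂                                ≡⟨ eq ⟩
    x * u₂ + y * v₁                                ≡⟨ unscale u₂ v₁ h∣u₂ h∣v₁ ⟨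
    g * h * (x / g * (u₂ / h) + y / g * (v₁ / h))  ∎)
  where
  open ≡-Reasoning
  expand : ∀ g h x u y v → g * h * (x * u + y * v) ≡ x * g * (u * h) + y * g * (v * h)
  expand = solve-∀
  unscale : ∀ u v → h ∣ u → h ∣ v → g * h * (x / g * (u / h) + y / g * (v / h)) ≡ x * u + y * v
  unscale u v h∣u h∣v = trans (expand g h (x / g) (u / h) (y / g) (v / h))
    (cong₂ _+_ (cong₂ _*_ (m/n*n≡m g∣x) (m/n*n≡m h∣u)) (cong₂ _*_ (m/n*n≡m g∣y) (m/n*n≡m h∣v)))

n≤n^3 : ∀ n → n ≤ n ^ 3
n≤n^3 zero    = z≤n
n≤n^3 (suc n) = m≤m*n (suc n) (suc n ^ 2)

∈-++-remove : ∀ {x z : I} us vs → z ∈ us ++ x ∷ vs → z ≢ x → z ∈ us ++ vs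
∈-++-remove us vs z∈ z≢x with ∈-++⁻ us z∈
... | inj₁ z∈us         = ∈-++⁺ˡ z∈us
... | inj₂ (here z≡x)   = contradiction z≡x z≢x
... | inj₂ (there z∈vs) = ∈-++⁺ʳ us z∈vs

length≤-injection : ∀ {f : I → K} {xs ys} → Unique xs →
  (∀ {u v} → u ∈ xs → v ∈ xs → f u ≡ f v → u ≡ v) → (∀ {u} → u ∈ xs → f u ∈ ys) →
  length xs ≤ length ys
length≤-injection {xs = []} _ _ _ = z≤n
length≤-injection {f = f} {x ∷ xs} (x∉xs ∷ uniq) inj into with ∈-∃++ (into (here refl))
... | us , vs , refl = begin
  suc (length xs)        ≤⟨ s≤s (length≤-injection uniq (λ u∈ v∈ → inj (there u∈) (there v∈)) into′) ⟩
  suc (length (us ++ vs)) ≡⟨ length-++-sucʳ us (f x) vs ⟨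
  length (us ++ f x ∷ vs) ∎
  where
  open ≤-Reasoning
  into′ : ∀ {u} → u ∈ xs → f u ∈ us ++ vs
  into′ u∈xs = ∈-++-remove us vs (into (there u∈xs))
    (λ fu≡fx → All.lookup x∉xs u∈xs (inj (here refl) (there u∈xs) (sym fu≡fx)))

indicator : ∀ {P : Set} → Dec P → ℕ
indicator (yes _) = 1
indicator (no _)  = 0

length-filter≡sum-indicator : ∀ {Q : I → Set} (Q? : Decidable Q) xs →
  length (filter Q? xs) ≡ sum (map (λ x → indicator (Q? x)) xs)
length-filter≡sum-indicator Q? []       = refl
length-filter≡sum-indicator Q? (x ∷ xs) with Q? x
... | yes _ = cong suc (length-filter≡sum-indicator Q? xs)
... | no _  = length-filter≡sum-indicator Q? xs

length-filter-split : ∀ {Q R : I → Set} (Q? : Decidable Q) (R? : Decidable R) xs →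
  length (filter Q? xs) ≡ length (filter (Q? ∩? R?) xs) + length (filter (Q? ∩? ∁? R?) xs)
length-filter-split Q? R? []       = refl
length-filter-split Q? R? (x ∷ xs) with Q? x | R? x
... | yes _ | yes _ = cong suc (length-filter-split Q? R? xs)
... | yes _ | no _  = trans (cong suc (length-filter-split Q? R? xs)) (sym (+-suc _ _))
... | no _  | _     = length-filter-split Q? R? xs

sum-map-+ : ∀ (f g : I → ℕ) xs → sum (map (λ x → f x + g x) xs) ≡ sum (map f xs) + sum (map g xs)
sum-map-+ f g []       = refl
sum-map-+ f g (x ∷ xs) = trans (cong (f x + g x +_) (sum-map-+ f g xs)) (+-+-comm (f x) (g x) _ _)
  where
  +-+-comm : ∀ m n o p → m + n + (o + p) ≡ m + o + (n + p)
  +-+-comm = solve-∀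

sum-map-0 : ∀ (xs : List I) → sum (map (λ _ → 0) xs) ≡ 0
sum-map-0 []       = refl
sum-map-0 (_ ∷ xs) = sum-map-0 xs

sum-map-comm : ∀ (f : I → K → ℕ) xs ys →
  sum (map (λ x → sum (map (f x) ys)) xs) ≡ sum (map (λ y → sum (map (λ x → f x y) xs)) ys)
sum-map-comm f []       ys = sym (sum-map-0 ys)
sum-map-comm f (x ∷ xs) ys =
  trans (cong (sum (map (f x) ys) +_) (sum-map-comm f xs ys)) (sym (sum-map-+ (f x) _ ys))

sum-map-cartesianProduct : ∀ (f : I × K → ℕ) xs ys →
  sum (map f (cartesianProduct xs ys)) ≡ sum (map (λ x → sum (map (λ y → f (x , y)) ys)) xs)
sum-map-cartesianProduct f []       ys = refl
sum-map-cartesianProduct f (x ∷ xs) ys = begin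
  sum (map f (map (x ,_) ys ++ cartesianProduct xs ys))
    ≡⟨ cong sum (map-++ f (map (x ,_) ys) _) ⟩
  sum (map f (map (x ,_) ys) ++ map f (cartesianProduct xs ys))
    ≡⟨ sum-++ (map f (map (x ,_) ys)) _ ⟩
  sum (map f (map (x ,_) ys)) + sum (map f (cartesianProduct xs ys))
    ≡⟨ cong₂ _+_ (cong sum (map-∘ ys)) (sym (sum-map-cartesianProduct f xs ys)) ⟨
  sum (map (λ y → f (x , y)) ys) + sum (map (λ x → sum (map (λ y → f (x , y)) ys)) xs) ∎
  where open ≡-Reasoning

sum-map-≤ : ∀ {f : I → ℕ} {k} {xs} → All (λ x → f x ≤ k) xs → sum (map f xs) ≤ length xs * k
sum-map-≤ []           = z≤n
sum-map-≤ (fx≤k ∷ all) = +-mono-≤ fx≤k (sum-map-≤ all)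

length-filter-cartesianProduct : ∀ {Q : I × K → Set} (Q? : Decidable Q) xs ys →
  length (filter Q? (cartesianProduct xs ys)) ≡ sum (map (λ x → sum (map (λ y → indicator (Q? (x , y))) ys)) xs)
length-filter-cartesianProduct Q? xs ys =
  trans (length-filter≡sum-indicator Q? (cartesianProduct xs ys))
        (sum-map-cartesianProduct (λ p → indicator (Q? p)) xs ys)

count-by-rows : ∀ {Q : I × K → Set} (Q? : Decidable Q) xs ys →
  length (filter Q? (cartesianProduct xs ys)) ≡ sum (map (λ x → length (filter (λ y → Q? (x , y)) ys)) xs)
count-by-rows Q? xs ys = trans (length-filter-cartesianProduct Q? xs ys)
  (cong sum (map-cong (λ x → sym (length-filter≡sum-indicator (λ y → Q? (x , y)) ys)) xs))

count-by-columns : ∀ {Q : I × K → Set} (Q? : Decidable Q) xs ys →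
  length (filter Q? (cartesianProduct xs ys)) ≡ sum (map (λ y → length (filter (λ x → Q? (x , y)) xs)) ys)
count-by-columns Q? xs ys = trans (length-filter-cartesianProduct Q? xs ys)
  (trans (sum-map-comm (λ x y → indicator (Q? (x , y))) xs ys)
    (cong sum (map-cong (λ y → sym (length-filter≡sum-indicator (λ x → Q? (x , y)) xs)) ys)))

-- With (A , a) = g (A' , a') and (B , b) = h (B' , b'), this says b' ≤ A'.
ChargedToPoint : Point → Line → Set
ChargedToPoint (A , a) (B , b) = b * gcd A a ≤ A * gcd B b

chargedToPoint? : Decidable (uncurry ChargedToPoint)
chargedToPoint? ((A , a) , (B , b)) = b * gcd A a ≤? A * gcd B b

incident-swap : ∀ {c} p l → Incident c (p , l) → Incident c (l , p)
incident-swap {c} (A , a) (B , b) e = trans (*-comm B A) (trans e (cong (_+ c) (*-comm a b)))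

incident-cross : ∀ {c} X Y U₁ V₁ U₂ V₂ →
  Incident c ((X , Y) , (U₁ , V₁)) → Incident c ((X , Y) , (U₂ , V₂)) →
  X * U₁ + Y * V₂ ≡ X * U₂ + Y * V₁
incident-cross {c} X Y U₁ V₁ U₂ V₂ e₁ e₂ = begin
  X * U₁ + Y * V₂      ≡⟨ cong (_+ Y * V₂) e₁ ⟩
  Y * V₁ + c + Y * V₂  ≡⟨ exchange (Y * V₁) c (Y * V₂) ⟩
  Y * V₂ + c + Y * V₁  ≡⟨ cong (_+ Y * V₁) e₂ ⟨
  X * U₂ + Y * V₁      ∎
  where
  open ≡-Reasoning
  exchange : ∀ m n o → m + n + o ≡ o + n + m
  exchange = solve-∀

gcd∣incident-line : ∀ {c} p l → Incident c (p , l) → uncurry gcd l ∣ c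
gcd∣incident-line (A , a) (B , b) e =
  ∣m+n∣m⇒∣n (subst (gcd B b ∣_) e (∣n⇒∣m*n A (gcd[m,n]∣m B b))) (∣n⇒∣m*n a (gcd[m,n]∣n B b))

gcd-≡⇒∣ : ∀ m₁ n₁ m₂ n₂ → gcd m₁ n₁ ≡ gcd m₂ n₂ → gcd m₁ n₁ ∣ m₂ × gcd m₁ n₁ ∣ n₂
gcd-≡⇒∣ m₁ n₁ m₂ n₂ eq =
  subst (_∣ m₂) (sym eq) (gcd[m,n]∣m m₂ n₂) , subst (_∣ n₂) (sym eq) (gcd[m,n]∣n m₂ n₂)

lines-charged-to-point-gcd-injective : ∀ {c A a B₁ b₁ B₂ b₂} →
  0 < A → 0 < B₁ → 0 < b₁ → 0 < b₂ →
  Incident c ((A , a) , (B₁ , b₁)) → Incident c ((A , a) , (B₂ , b₂)) →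
  ChargedToPoint (A , a) (B₁ , b₁) → ChargedToPoint (A , a) (B₂ , b₂) →
  gcd B₁ b₁ ≡ gcd B₂ b₂ → (B₁ , b₁) ≡ (B₂ , b₂)
lines-charged-to-point-gcd-injective {c} {A} {a} {B₁} {b₁} {B₂} {b₂}
                                     0<A 0<B₁ 0<b₁ 0<b₂ e₁ e₂ ch₁ ch₂ h≡ =
  cong₂ _,_ B₁≡B₂ b₁≡b₂
  where
  g = gcd A a
  h = gcd B₁ b₁
  instance
    _ : NonZero g
    _ = >-nonZero (gcd>0 a 0<A)
    _ : NonZero h
    _ = >-nonZero (gcd>0 b₁ 0<B₁)
  h∣B₂ : h ∣ B₂
  h∣B₂ = proj₁ (gcd-≡⇒∣ B₁ b₁ B₂ b₂ h≡)
  h∣b₂ : h ∣ b₂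
  h∣b₂ = proj₂ (gcd-≡⇒∣ B₁ b₁ B₂ b₂ h≡)
  reduced : A / g * (B₁ / h) + a / g * (b₂ / h) ≡ A / g * (B₂ / h) + a / g * (b₁ / h)
  reduced = cross-/ (gcd[m,n]∣m A a) (gcd[m,n]∣n A a) (gcd[m,n]∣m B₁ b₁) h∣B₂ (gcd[m,n]∣n B₁ b₁) h∣b₂
                    (incident-cross A a B₁ b₁ B₂ b₂ e₁ e₂)
  b₁′≤A′ : b₁ / h ≤ A / g
  b₁′≤A′ = cross-≤⇒/-≤ (gcd[m,n]∣n B₁ b₁) (gcd[m,n]∣m A a) ch₁
  b₂′≤A′ : b₂ / h ≤ A / g
  b₂′≤A′ = cross-≤⇒/-≤ h∣b₂ (gcd[m,n]∣m A a) (subst (λ k → b₂ * g ≤ A * k) (sym h≡) ch₂)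
  0<b′ : ∀ {b} → 0 < b → h ∣ b → 0 < b / h
  0<b′ 0<b h∣b = m≥n⇒m/n>0 (∣⇒≤ {{>-nonZero 0<b}} h∣b)
  b₁≡b₂ : b₁ ≡ b₂
  b₁≡b₂ = /-injective (gcd[m,n]∣n B₁ b₁) h∣b₂
    (coprime-window (coprime-/gcd A a) reduced
      (≤-<-trans b₁′≤A′ (m<n+m (A / g) (0<b′ 0<b₂ h∣b₂)))
      (≤-<-trans b₂′≤A′ (m<n+m (A / g) (0<b′ 0<b₁ (gcd[m,n]∣n B₁ b₁)))))
  B₁≡B₂ : B₁ ≡ B₂
  B₁≡B₂ = *-cancelˡ-≡ B₁ B₂ A {{>-nonZero 0<A}}
    (trans e₁ (trans (cong (λ b → a * b + c) b₁≡b₂) (sym e₂)))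

points-charged-to-line-gcd-injective : ∀ {c A₁ a₁ A₂ a₂ B b} →
  0 < A₁ → 0 < B → 0 < b →
  Incident c ((A₁ , a₁) , (B , b)) → Incident c ((A₂ , a₂) , (B , b)) →
  ¬ ChargedToPoint (A₁ , a₁) (B , b) → ¬ ChargedToPoint (A₂ , a₂) (B , b) →
  gcd A₁ a₁ ≡ gcd A₂ a₂ → (A₁ , a₁) ≡ (A₂ , a₂)
points-charged-to-line-gcd-injective {c} {A₁} {a₁} {A₂} {a₂} {B} {b}
                                     0<A₁ 0<B 0<b e₁ e₂ ch₁ ch₂ g≡ =
  cong₂ _,_ A₁≡A₂ a₁≡a₂
  where
  g = gcd A₁ a₁
  h = gcd B b
  instance
    _ : NonZero g
    _ = >-nonZero (gcd>0 a₁ 0<A₁)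
    _ : NonZero h
    _ = >-nonZero (gcd>0 b 0<B)
  g∣A₂ : g ∣ A₂
  g∣A₂ = proj₁ (gcd-≡⇒∣ A₁ a₁ A₂ a₂ g≡)
  g∣a₂ : g ∣ a₂
  g∣a₂ = proj₂ (gcd-≡⇒∣ A₁ a₁ A₂ a₂ g≡)
  reduced : B / h * (A₁ / g) + b / h * (a₂ / g) ≡ B / h * (A₂ / g) + b / h * (a₁ / g)
  reduced = cross-/ (gcd[m,n]∣m B b) (gcd[m,n]∣n B b) (gcd[m,n]∣m A₁ a₁) g∣A₂ (gcd[m,n]∣n A₁ a₁) g∣a₂
                    (incident-cross B b A₁ a₁ A₂ a₂ (incident-swap (A₁ , a₁) (B , b) e₁)
                                                    (incident-swap (A₂ , a₂) (B , b) e₂))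
  reduced′ : b / h * (a₂ / g) + B / h * (A₁ / g) ≡ b / h * (a₁ / g) + B / h * (A₂ / g)
  reduced′ = trans (+-comm (b / h * (a₂ / g)) _) (trans reduced (+-comm (B / h * (A₂ / g)) _))
  A₁′<b′ : A₁ / g < b / h
  A₁′<b′ = cross-<⇒/-< (gcd[m,n]∣m A₁ a₁) (gcd[m,n]∣n B b) (≰⇒> ch₁)
  A₂′<b′ : A₂ / g < b / h
  A₂′<b′ = cross-<⇒/-< g∣A₂ (gcd[m,n]∣n B b) (subst (λ k → A₂ * h < b * k) (sym g≡) (≰⇒> ch₂))
  A₁≡A₂ : A₁ ≡ A₂
  A₁≡A₂ = /-injective (gcd[m,n]∣m A₁ a₁) g∣A₂ (sym
    (coprime-window (coprime-sym (coprime-/gcd B b)) reduced′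
      (<-≤-trans A₂′<b′ (m≤n+m (b / h) (A₁ / g)))
      (<-≤-trans A₁′<b′ (m≤n+m (b / h) (A₂ / g)))))
  a₁≡a₂ : a₁ ≡ a₂
  a₁≡a₂ = *-cancelʳ-≡ a₁ a₂ b {{>-nonZero 0<b}}
    (+-cancelʳ-≡ c _ _ (trans (sym e₁) (trans (cong (_* B) A₁≡A₂) e₂)))

Positive : ℕ × ℕ → Set
Positive p = 0 < proj₁ p × 0 < proj₂ p

divisors : ℕ → List ℕ
divisors c = filter (_∣? c) (applyUpTo suc c)

∣⇒∈-divisors : ∀ {c d} .{{_ : NonZero c}} → 0 < d → d ∣ c → d ∈ divisors c
∣⇒∈-divisors {c} {suc _} _ d∣c = ∈-filter⁺ (_∣? c) (∈-applyUpTo⁺ suc (∣⇒≤ d∣c)) d∣c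

chargedToPoint-incident? : (c : ℕ) → Decidable (Incident c ∩ uncurry ChargedToPoint)
chargedToPoint-incident? c = incident? c ∩? chargedToPoint?

chargedToLine-incident? : (c : ℕ) → Decidable (Incident c ∩ ∁ (uncurry ChargedToPoint))
chargedToLine-incident? c = incident? c ∩? ∁? chargedToPoint?

charged-to-point-≤τ : ∀ c .{{_ : NonZero c}} p → Positive p →
  (L : List Line) → Unique L → All Positive L →
  length (filter (λ l → chargedToPoint-incident? c (p , l)) L) ≤ τ c
charged-to-point-≤τ c (A , a) (0<A , _) L L! L⁺ = length≤-injection (Unique.filter⁺ Q? L!) injective into
  where
  Q? : Decidable (λ l → (Incident c ∩ uncurry ChargedToPoint) ((A , a) , l))
  Q? l = chargedToPoint-incident? c ((A , a) , l)
  S : List Line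
  S = filter Q? L
  injective : ∀ {l₁ l₂} → l₁ ∈ S → l₂ ∈ S → uncurry gcd l₁ ≡ uncurry gcd l₂ → l₁ ≡ l₂
  injective l₁∈S l₂∈S with ∈-filter⁻ Q? l₁∈S | ∈-filter⁻ Q? l₂∈S
  ... | l₁∈L , e₁ , ch₁ | l₂∈L , e₂ , ch₂ = lines-charged-to-point-gcd-injective
        0<A (proj₁ (All.lookup L⁺ l₁∈L)) (proj₂ (All.lookup L⁺ l₁∈L)) (proj₂ (All.lookup L⁺ l₂∈L))
        e₁ e₂ ch₁ ch₂
  into : ∀ {l} → l ∈ S → uncurry gcd l ∈ divisors c
  into {B , b} l∈S with ∈-filter⁻ Q? l∈S
  ... | l∈L , e , _ = ∣⇒∈-divisors (gcd>0 b (proj₁ (All.lookup L⁺ l∈L)))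
                                   (gcd∣incident-line (A , a) (B , b) e)

charged-to-line-≤τ : ∀ c .{{_ : NonZero c}} l → Positive l →
  (P : List Point) → Unique P → All Positive P →
  length (filter (λ p → chargedToLine-incident? c (p , l)) P) ≤ τ c
charged-to-line-≤τ c (B , b) (0<B , 0<b) P P! P⁺ = length≤-injection (Unique.filter⁺ Q? P!) injective into
  where
  Q? : Decidable (λ p → (Incident c ∩ ∁ (uncurry ChargedToPoint)) (p , (B , b)))
  Q? p = chargedToLine-incident? c (p , (B , b))
  S : List Point
  S = filter Q? P
  injective : ∀ {p₁ p₂} → p₁ ∈ S → p₂ ∈ S → uncurry gcd p₁ ≡ uncurry gcd p₂ → p₁ ≡ p₂
  injective p₁∈S p₂∈S with ∈-filter⁻ Q? p₁∈S | ∈-filter⁻ Q? {xs = P} p₂∈S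
  ... | p₁∈P , e₁ , ch₁ | _ , e₂ , ch₂ = points-charged-to-line-gcd-injective
        (proj₁ (All.lookup P⁺ p₁∈P)) 0<B 0<b e₁ e₂ ch₁ ch₂
  into : ∀ {p} → p ∈ S → uncurry gcd p ∈ divisors c
  into {A , a} p∈S with ∈-filter⁻ Q? p∈S
  ... | p∈P , e , _ = ∣⇒∈-divisors (gcd>0 a (proj₁ (All.lookup P⁺ p∈P)))
                                   (gcd∣incident-line (B , b) (A , a) (incident-swap (A , a) (B , b) e))

lemma2p3 : (c : ℕ) → .{{_ : NonZero c}} →
    (P : List Point) → Unique P → All (λ p → 0 < proj₁ p × 0 < proj₂ p) P →
    (L : List Line) → Unique L → All (λ l → 0 < proj₁ l × 0 < proj₂ l) L →
    incidences c P L ≤ (length P + length L) * τ c ^ 3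
lemma2p3 c P P! P⁺ L L! L⁺ = begin
  incidences c P L
    ≡⟨ length-filter-split (incident? c) chargedToPoint? (cartesianProduct P L) ⟩
  length (filter (chargedToPoint-incident? c) (cartesianProduct P L)) +
  length (filter (chargedToLine-incident? c) (cartesianProduct P L))
    ≡⟨ cong₂ _+_ (count-by-rows (chargedToPoint-incident? c) P L)
                 (count-by-columns (chargedToLine-incident? c) P L) ⟩
  sum (map (λ p → length (filter (λ l → chargedToPoint-incident? c (p , l)) L)) P) +
  sum (map (λ l → length (filter (λ p → chargedToLine-incident? c (p , l)) P)) L)
    ≤⟨ +-mono-≤ (sum-map-≤ (All.map (λ {p} p⁺ → charged-to-point-≤τ c p p⁺ L L! L⁺) P⁺))
                (sum-map-≤ (All.map (λ {l} l⁺ → charged-to-line-≤τ c l l⁺ P P! P⁺) L⁺)) ⟩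
  length P * τ c + length L * τ c
    ≡⟨ *-distribʳ-+ (τ c) (length P) (length L) ⟨
  (length P + length L) * τ c
    ≤⟨ *-monoʳ-≤ (length P + length L) (n≤n^3 (τ c)) ⟩
  (length P + length L) * τ c ^ 3 ∎
  where open ≤-Reasoning
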